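{- Let $R_n$ denote the number of $p_2$-orientations of the path $P_n$. Then $R_1=0$, $R_2=2$, $R_3=2$, $R_4=4$, and for all $n\ge 5$, $$R_n = R_{n-1}+2R_{n-2}-R_{n-4}.$$
   Context: Parallel Diffusion on a finite simple graph $G$: a configuration assigns an integer stack size $|v|$ (possibly negative) to each vertex. In one step all vertices fire simultaneously: each vertex sends one chip to each neighbour with strictly smaller stack size. Starting from $C_0$, $C_{t+1}$ is obtained from $C_t$ by one step. A configuration $D$ is a $p_2$-configuration if there are $C_0$ and $N$ such that $C_{t+2}=C_t$ and $C_{t+1}\ne C_t$ for all $t\ge N$, and $D=C_t$ for some $t\ge N$. The path $P_n$ has vertices $v_1,\dots,v_n$ and edges $e_i=v_iv_{i+1}$. A path orientation assigns to each edge either "flat" or one of its two directions. A configuration induces the path orientation in which each edge is directed from its endpoint with larger stack size to its endpoint with smaller stack size, and is flat if the stack sizes are equal. A $p_2$-orientation is a path orientation induced by some $p_2$-configuration. -}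

module Defs where

open import Data.Nat using (ℕ; zero; suc; _≤_; _+_; _*_)
open import Data.Integer using (ℤ; _<?_) renaming (_+_ to _+ℤ_)
open import Data.Integer as ℤ using ()
open import Data.Fin using (Fin; toℕ; inject₁) renaming (suc to fsuc)
open import Data.Vec using (Vec; lookup; tabulate)
open import Data.List using (List; allFin; foldr; map; length)
open import Data.List.Membership.Propositional using (_∈_)
open import Data.List.Relation.Unary.Unique.Propositional using (Unique)
open import Data.Bool using (Bool; if_then_else_; _∨_)
open import Data.Product using (Σ; ∃; _×_; _,_)
open import Function.Bundles using (_⇔_)
open import Relation.Nullary using (¬_; does)
open import Relation.Binary.PropositionalEquality using (_≡_)
import Data.Nat as ℕ

record SimpleGraph (n : ℕ) : Set where
  field
    adj   : Fin n → Fin n → Bool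
    sym   : ∀ u v → adj u v ≡ adj v u
    irrefl : ∀ v → adj v v ≡ Data.Bool.false

open SimpleGraph public

-- A configuration: an integer stack size for every vertex.
Config : ℕ → Set
Config n = Vec ℤ n

sumℤ : List ℤ → ℤ
sumℤ = foldr _+ℤ_ (ℤ.+ 0)

-- Net number of chips vertex v receives from vertex u in one step:
-- u sends one chip to v if |u| > |v|; v sends one chip to u if |v| > |u|.
flow : ∀ {n} → SimpleGraph n → Config n → Fin n → Fin n → ℤ
flow G C u v =
  if adj G u v
  then (if does (lookup C v <? lookup C u) then ℤ.+ 1
        else if does (lookup C u <? lookup C v) then ℤ.- (ℤ.+ 1)
        else ℤ.+ 0)
  else ℤ.+ 0

step : ∀ {n} → SimpleGraph n → Config n → Config n
step {n} G C = tabulate λ v → lookup C v +ℤ sumℤ (map (λ u → flow G C u v) (allFin n))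

iterate : ∀ {n} → SimpleGraph n → ℕ → Config n → Config n
iterate G zero    C = C
iterate G (suc t) C = step G (iterate G t C)

IsP2Config : ∀ {n} → SimpleGraph n → Config n → Set
IsP2Config {n} G D =
  Σ (Config n) λ C₀ → Σ ℕ λ N →
    (∀ t → N ≤ t →
        (iterate G (suc (suc t)) C₀ ≡ iterate G t C₀)
      × ¬ (iterate G (suc t) C₀ ≡ iterate G t C₀))
    × Σ ℕ λ t → N ≤ t × D ≡ iterate G t C₀

-- The path P_n (n = suc m): vertices v_1..v_n are Fin (suc m)
-- (v_{i+1} is the Fin element with toℕ = i); v_i ~ v_j iff |i - j| = 1.

pathAdj : ∀ {n} → Fin n → Fin n → Bool
pathAdj i j = does (suc (toℕ i) ℕ.≟ toℕ j) ∨ does (suc (toℕ j) ℕ.≟ toℕ i)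

path : (n : ℕ) → SimpleGraph n
path n = record { adj = pathAdj ; sym = symP ; irrefl = irr }
  where
  open import Data.Bool.Properties using (∨-comm)
  open import Relation.Binary.PropositionalEquality using (refl; cong)
  open import Relation.Nullary using (yes; no)
  open import Data.Nat.Properties using (<-irrefl; n<1+n)
  open import Data.Empty using (⊥-elim)
  symP : ∀ u v → pathAdj u v ≡ pathAdj v u
  symP u v = ∨-comm (does (suc (toℕ u) ℕ.≟ toℕ v)) _
  irr : ∀ v → pathAdj v v ≡ Data.Bool.false
  lem : ∀ k → (suc k ℕ.≡ᵇ k) ≡ Data.Bool.false
  lem zero    = refl
  lem (suc k) = lem k
  irr v rewrite lem (toℕ v) = refl

-- State of an edge e_i = v_i v_{i+1} in a path orientation.
data EdgeDir : Set where
  flat     : EdgeDir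
  forward  : EdgeDir   -- directed v_i → v_{i+1}
  backward : EdgeDir   -- directed v_{i+1} → v_i

-- Path orientations of P_(suc m): one EdgeDir for each of the m edges.
PathOrientation : ℕ → Set
PathOrientation m = Vec EdgeDir m

induced : ∀ {m} → Config (suc m) → PathOrientation m
induced C = tabulate λ k →
  if does (lookup C (fsuc k) <? lookup C (inject₁ k)) then forward
  else if does (lookup C (inject₁ k) <? lookup C (fsuc k)) then backward
  else flat

IsP2Orientation : ∀ {m} → PathOrientation m → Set
IsP2Orientation {m} o =
  Σ (Config (suc m)) λ D → IsP2Config (path (suc m)) D × induced D ≡ o

-- The number of p₂-orientations of P_n (n ≥ 1) equals k: there is a
-- duplicate-free list containing exactly the p₂-orientations, of length k.
NumP2Orientations≡ : (n : ℕ) → ℕ → Set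
NumP2Orientations≡ zero    k = Data.Empty.⊥ where import Data.Empty
NumP2Orientations≡ (suc m) k =
  Σ (List (PathOrientation m)) λ L →
    Unique L × (∀ o → (o ∈ L) ⇔ IsP2Orientation o) × length L ≡ k

module Submission where

-- On a path, a step changes the stack of v_i by s_{i-1} - s_i, where s_i in {-1, 0, 1} is the
-- number of chips crossing e_i rightwards. So a configuration has period two iff every edge
-- reverses in one step, and edge e_i reverses iff its new gap (|v_i| - |v_{i+1}|) + s_{i-1} - 2 s_i + s_{i+1}
-- has the opposite sign. Shrinking the gap to +-1 only helps, so the p2-orientations are exactly
-- the orientations that are not entirely flat and in which every triple of consecutive edges (with
-- flat edges added at both ends) obeys a local rule; the staircase with gaps +-1 realises each of them.
-- Counting admissible continuations by the last two letters, and using the symmetry forward <-> backward,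
-- leaves the counts A, B, C, D after (flat, forward), (forward, flat), (forward, backward) and
-- (forward, forward), with A' = B + C, B' = A, C' = B + C + D, D' = C and R_{k+2} = 2 A_k;
-- eliminating B, C, D gives the recurrence.

open import Defs hiding (sym)
open import Data.Nat using (ℕ; zero; suc; _+_; _*_; pred; z≤n; s≤s)
open import Data.Integer as ℤ using (ℤ; +_; +[1+_]; -[1+_]; -_; _-_; _<_; _<?_) renaming (_+_ to _+ℤ_)
import Data.Integer.Properties as ℤP
import Data.Integer.Tactic.RingSolver as ℤSolver
import Data.Nat.Tactic.RingSolver as ℕSolver
import Data.Nat.Properties as ℕ
import Function.Properties.Equivalence as ⇔
open import Data.Fin using (Fin) renaming (zero to fzero; suc to fsuc)
open import Data.Vec using (Vec; []; _∷_; head; lookup; tabulate)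
import Data.Vec.Properties as Vec
open import Data.List using (List; []; _∷_; _++_; length)
import Data.List as List
open import Data.List.Membership.Propositional using (_∈_)
open import Data.List.Membership.Propositional.Properties using (∈-++⁺ˡ; ∈-++⁺ʳ; ∈-++⁻; ∈-map⁺; ∈-map⁻)
open import Data.List.Relation.Unary.Any using (here)
open import Data.List.Relation.Unary.All using ([])
import Data.List.Relation.Unary.AllPairs as AllPairs
open import Data.List.Relation.Unary.Unique.Propositional using (Unique)
import Data.List.Relation.Unary.Unique.Propositional.Properties as Unique
open import Data.List.Relation.Binary.Disjoint.Propositional using (Disjoint)
import Data.List.Properties as List
open import Data.Bool using (Bool; true; false; if_then_else_; T)
open import Data.Product using (Σ; _×_; _,_; proj₁)
open import Data.Sum using (_⊎_; inj₁; inj₂)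
open import Function using (id)
open import Function.Bundles using (_⇔_; mk⇔; Equivalence)
open import Relation.Nullary using (¬_; Dec; does; yes; no)
open import Relation.Nullary.Decidable using (isYes; fromWitness; toWitness)
open import Relation.Binary.PropositionalEquality
open import Data.Empty using (⊥-elim)
open import Data.Unit using (⊤; tt)

-- The net number of chips an edge carries from v_i to v_{i+1} in one step.
flux : EdgeDir → ℤ
flux flat     = + 0
flux forward  = + 1
flux backward = - + 1

opposite : EdgeDir → EdgeDir
opposite flat     = flat
opposite forward  = backward
opposite backward = forward

signDir : ℤ → EdgeDir
signDir (+ 0)    = flat
signDir +[1+ _ ] = forward
signDir -[1+ _ ] = backward

-- Definitionally the entry of induced for an edge with stacks x and y.
orient : ℤ → ℤ → EdgeDir
orient x y = if does (y <? x) then forward else if does (x <? y) then backward else flat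

signDir-flux : ∀ c → signDir (flux c) ≡ c
signDir-flux flat     = refl
signDir-flux forward  = refl
signDir-flux backward = refl

flux-opposite : ∀ c → flux (opposite c) ≡ - flux c
flux-opposite flat     = refl
flux-opposite forward  = refl
flux-opposite backward = refl

signDir-neg : ∀ z → signDir (- z) ≡ opposite (signDir z)
signDir-neg (+ 0)    = refl
signDir-neg +[1+ _ ] = refl
signDir-neg -[1+ _ ] = refl

flux≡-flux⇒opposite : ∀ c e → flux e ≡ - flux c → e ≡ opposite c
flux≡-flux⇒opposite c e eq = begin
  e                        ≡⟨ sym (signDir-flux e) ⟩
  signDir (flux e)         ≡⟨ cong signDir eq ⟩
  signDir (- flux c)       ≡⟨ signDir-neg (flux c) ⟩
  opposite (signDir (flux c)) ≡⟨ cong opposite (signDir-flux c) ⟩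
  opposite c               ∎
  where open ≡-Reasoning

signDir-positive : ∀ {z} → + 0 < z → signDir z ≡ forward
signDir-positive {+[1+ _ ]} _ = refl
signDir-positive {+ 0} (ℤ.+<+ ())

signDir-negative : ∀ {z} → z < + 0 → signDir z ≡ backward
signDir-negative { -[1+ _ ]} _ = refl
signDir-negative {+ _} (ℤ.+<+ ())

orient≡signDir : ∀ x y → orient x y ≡ signDir (x - y)
orient≡signDir x y with y <? x | x <? y
... | yes y<x | _       = sym (signDir-positive (subst (_< x - y) (ℤP.+-inverseʳ y) (ℤP.+-monoˡ-< (- y) y<x)))
... | no _    | yes x<y = sym (signDir-negative (subst (x - y <_) (ℤP.+-inverseʳ y) (ℤP.+-monoˡ-< (- y) x<y)))
... | no y≮x  | no x≮y  rewrite ℤP.≤-antisym (ℤP.≮⇒≥ y≮x) (ℤP.≮⇒≥ x≮y) | ℤP.+-inverseʳ y = refl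

module _ {n} (G : SimpleGraph n) where

  isP2Config⇒period-two : ∀ D → IsP2Config G D → step G (step G D) ≡ D × ¬ step G D ≡ D
  isP2Config⇒period-two D (C₀ , N , periodic , t , N≤t , refl) = periodic t N≤t

  period-two⇒isP2Config : ∀ D → step G (step G D) ≡ D → ¬ step G D ≡ D → IsP2Config G D
  period-two⇒isP2Config D back moves = D , 0 , (λ t _ → periodic t) , 0 , z≤n , refl
    where
    orbit : ∀ t → iterate G t D ≡ D ⊎ iterate G t D ≡ step G D
    orbit zero = inj₁ refl
    orbit (suc t) with orbit t
    ... | inj₁ eq = inj₂ (cong (step G) eq)
    ... | inj₂ eq = inj₁ (trans (cong (step G) eq) back)

    periodic : ∀ t → iterate G (suc (suc t)) D ≡ iterate G t D × ¬ iterate G (suc t) D ≡ iterate G t D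
    periodic t with orbit t
    ... | inj₁ eq rewrite eq = back , moves
    ... | inj₂ eq rewrite eq = cong (step G) back , λ fixed → moves (sym (trans (sym back) fixed))

-- One step of diffusion on a path whose left end also receives the flux of a virtual edge p.
diffuse : ∀ {n} → EdgeDir → Config n → Config n
diffuse p []          = []
diffuse p (x ∷ [])    = x +ℤ flux p ∷ []
diffuse p (x ∷ y ∷ r) = x +ℤ (flux p - flux (orient x y)) ∷ diffuse (orient x y) (y ∷ r)

fluxAtLeftEnd : ∀ {n} → EdgeDir → Fin n → ℤ
fluxAtLeftEnd p fzero    = flux p
fluxAtLeftEnd p (fsuc _) = + 0

inflow : ∀ {n} → Config n → Fin n → ℤ
inflow {n} C v = sumℤ (List.tabulate λ u → flow (path n) C u v)

inflow-from-right : ∀ x y → (if does (x <? y) then + 1 else if does (y <? x) then - + 1 else + 0) ≡ - flux (orient x y)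
inflow-from-right x y with x <? y | y <? x
... | yes x<y | yes y<x = ⊥-elim (ℤP.<-asym x<y y<x)
... | yes _   | no _    = refl
... | no _    | yes _   = refl
... | no _    | no _    = refl

inflow-from-left : ∀ x y → (if does (y <? x) then + 1 else if does (x <? y) then - + 1 else + 0) ≡ flux (orient x y)
inflow-from-left x y with y <? x
... | yes _ = refl
... | no _ with x <? y
...   | yes _ = refl
...   | no _  = refl

sum-zeros : ∀ n → sumℤ (List.tabulate {n = n} λ _ → + 0) ≡ + 0
sum-zeros zero    = refl
sum-zeros (suc n) = cong (+ 0 +ℤ_) (sum-zeros n)

inflow-∷-fzero : ∀ {n} x y (r : Config n) → inflow (x ∷ y ∷ r) fzero ≡ - flux (orient x y)
inflow-∷-fzero {n} x y r =
  trans (ℤP.+-identityˡ _) (trans (cong₂ _+ℤ_ (inflow-from-right x y) (sum-zeros n)) (ℤP.+-identityʳ _))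

inflow-∷-fsuc-fzero : ∀ {n} x y (r : Config n) →
  inflow (x ∷ y ∷ r) (fsuc fzero) ≡ flux (orient x y) +ℤ inflow (y ∷ r) fzero
inflow-∷-fsuc-fzero x y r = cong (_+ℤ inflow (y ∷ r) fzero) (inflow-from-left x y)

inflow-∷-fsuc-fsuc : ∀ {n} x y (r : Config n) v → inflow (x ∷ y ∷ r) (fsuc (fsuc v)) ≡ inflow (y ∷ r) (fsuc v)
inflow-∷-fsuc-fsuc x y r v = ℤP.+-identityˡ _

lookup-diffuse : ∀ {n} p (C : Config n) v → lookup (diffuse p C) v ≡ lookup C v +ℤ (fluxAtLeftEnd p v +ℤ inflow C v)
lookup-diffuse p (x ∷ []) fzero = cong (x +ℤ_) (sym (ℤP.+-identityʳ (flux p)))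
lookup-diffuse p (x ∷ y ∷ r) fzero = cong (λ z → x +ℤ (flux p +ℤ z)) (sym (inflow-∷-fzero x y r))
lookup-diffuse p (x ∷ y ∷ r) (fsuc fzero) = begin
  lookup (diffuse (orient x y) (y ∷ r)) fzero          ≡⟨ lookup-diffuse (orient x y) (y ∷ r) fzero ⟩
  y +ℤ (flux (orient x y) +ℤ inflow (y ∷ r) fzero)     ≡⟨ cong (y +ℤ_) (sym (inflow-∷-fsuc-fzero x y r)) ⟩
  y +ℤ inflow (x ∷ y ∷ r) (fsuc fzero)                 ≡⟨ cong (y +ℤ_) (sym (ℤP.+-identityˡ _)) ⟩
  y +ℤ (+ 0 +ℤ inflow (x ∷ y ∷ r) (fsuc fzero))        ∎
  where open ≡-Reasoning
lookup-diffuse p (x ∷ y ∷ r) (fsuc (fsuc v)) = begin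
  lookup (diffuse (orient x y) (y ∷ r)) (fsuc v)       ≡⟨ lookup-diffuse (orient x y) (y ∷ r) (fsuc v) ⟩
  lookup r v +ℤ (+ 0 +ℤ inflow (y ∷ r) (fsuc v))       ≡⟨ cong (λ z → lookup r v +ℤ (+ 0 +ℤ z)) (sym (inflow-∷-fsuc-fsuc x y r v)) ⟩
  lookup r v +ℤ (+ 0 +ℤ inflow (x ∷ y ∷ r) (fsuc (fsuc v))) ∎
  where open ≡-Reasoning

step-path : ∀ {n} (C : Config n) → step (path n) C ≡ diffuse flat C
step-path {n} C = trans (Vec.tabulate-cong lookup-step) (Vec.tabulate∘lookup (diffuse flat C))
  where
  noLeftFlux : (v : Fin n) → fluxAtLeftEnd flat v ≡ + 0
  noLeftFlux fzero    = refl
  noLeftFlux (fsuc _) = refl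
  lookup-step : ∀ v → lookup C v +ℤ sumℤ (List.map (λ u → flow (path n) C u v) (List.allFin n)) ≡ lookup (diffuse flat C) v
  lookup-step v = sym (begin
    lookup (diffuse flat C) v                              ≡⟨ lookup-diffuse flat C v ⟩
    lookup C v +ℤ (fluxAtLeftEnd flat v +ℤ inflow C v)     ≡⟨ cong (λ z → lookup C v +ℤ (z +ℤ inflow C v)) (noLeftFlux v) ⟩
    lookup C v +ℤ (+ 0 +ℤ inflow C v)                      ≡⟨ cong (lookup C v +ℤ_) (ℤP.+-identityˡ _) ⟩
    lookup C v +ℤ inflow C v                               ≡⟨ cong (λ l → lookup C v +ℤ sumℤ l) (sym (List.map-tabulate id (λ u → flow (path n) C u v))) ⟩
    lookup C v +ℤ sumℤ (List.map (λ u → flow (path n) C u v) (List.allFin n)) ∎)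
    where open ≡-Reasoning

_≟_ : (c d : EdgeDir) → Dec (c ≡ d)
flat     ≟ flat     = yes refl
flat     ≟ forward  = no λ ()
flat     ≟ backward = no λ ()
forward  ≟ flat     = no λ ()
forward  ≟ forward  = yes refl
forward  ≟ backward = no λ ()
backward ≟ flat     = no λ ()
backward ≟ forward  = no λ ()
backward ≟ backward = yes refl

-- The gap between the ends of an edge after one step, if it was δ before and the neighbouring edges are p and d.
newGap : EdgeDir → ℤ → EdgeDir → ℤ
newGap p δ d = δ +ℤ ((flux p - flux (signDir δ)) +ℤ (flux d - flux (signDir δ)))

reverses : EdgeDir → EdgeDir → EdgeDir → Bool
reverses p c d = isYes (signDir (newGap p (flux c) d) ≟ opposite c)

signDir≡forward⇒positive : ∀ {z} → signDir z ≡ forward → + 0 < z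
signDir≡forward⇒positive {+[1+ _ ]} _ = ℤ.+<+ (s≤s z≤n)
signDir≡forward⇒positive {+ 0} ()
signDir≡forward⇒positive { -[1+ _ ]} ()

signDir≡backward⇒negative : ∀ {z} → signDir z ≡ backward → z < + 0
signDir≡backward⇒negative { -[1+ _ ]} _ = ℤ.-<+
signDir≡backward⇒negative {+ 0} ()
signDir≡backward⇒negative {+[1+ _ ]} ()

-- An edge that reverses with some gap also reverses with the smallest gap of the same sign.
reverses-minimal : ∀ p δ d → signDir (newGap p δ d) ≡ opposite (signDir δ) → T (reverses p (signDir δ) d)
reverses-minimal p (+ 0) d flips = fromWitness flips
reverses-minimal p +[1+ k ] d flips = fromWitness (signDir-negative
  (ℤP.≤-<-trans (ℤP.+-monoˡ-≤ ((flux p - flux forward) +ℤ (flux d - flux forward)) (ℤ.+≤+ (s≤s z≤n)))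
                 (signDir≡backward⇒negative flips)))
reverses-minimal p -[1+ k ] d flips = fromWitness (signDir-positive
  (ℤP.<-≤-trans (signDir≡forward⇒positive flips)
                 (ℤP.+-monoˡ-≤ ((flux p - flux backward) +ℤ (flux d - flux backward)) (ℤ.-≤- z≤n))))

firstEdge : ∀ {m} → PathOrientation m → EdgeDir
firstEdge []      = flat
firstEdge (c ∷ _) = c

-- Every edge of w reverses in one step, p being the edge to the left of w (a missing edge counts as flat).
AllReverse : ∀ {m} → EdgeDir → PathOrientation m → Set
AllReverse p []      = ⊤
AllReverse p (c ∷ w) = T (reverses p c (firstEdge w)) × AllReverse c w

-- The configuration inducing w whose consecutive stack sizes differ by at most one.
staircase : ∀ {m} → ℤ → PathOrientation m → Config (suc m)
stairsBelow : ∀ {m} → ℤ → PathOrientation m → Config m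
staircase x w = x ∷ stairsBelow x w
stairsBelow x []      = []
stairsBelow x (c ∷ w) = staircase (x - flux c) w

x-[x-s]≡s : ∀ x s → x - (x - s) ≡ s
x-[x-s]≡s = ℤSolver.solve-∀

orient-staircase : ∀ x c → orient x (x - flux c) ≡ c
orient-staircase x c = begin
  orient x (x - flux c)      ≡⟨ orient≡signDir x (x - flux c) ⟩
  signDir (x - (x - flux c)) ≡⟨ cong signDir (x-[x-s]≡s x (flux c)) ⟩
  signDir (flux c)           ≡⟨ signDir-flux c ⟩
  c                          ∎
  where open ≡-Reasoning

induced-staircase : ∀ {m} x (w : PathOrientation m) → induced (staircase x w) ≡ w
induced-staircase x []          = refl
induced-staircase x (c ∷ [])    = cong (_∷ []) (orient-staircase x c)
induced-staircase x (c ∷ d ∷ w) = cong₂ _∷_ (orient-staircase x c) (induced-staircase (x - flux c) (d ∷ w))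

head-diffuse : ∀ {n} e y (r : Config n) → head (diffuse e (y ∷ r)) ≡ y +ℤ (flux e - flux (firstEdge (induced (y ∷ r))))
head-diffuse e y []      = cong (y +ℤ_) (sym (ℤP.+-identityʳ (flux e)))
head-diffuse e y (_ ∷ _) = refl

diffuse-∷ : ∀ {n} q x (V : Config (suc n)) →
  diffuse q (x ∷ V) ≡ x +ℤ (flux q - flux (orient x (head V))) ∷ diffuse (orient x (head V)) V
diffuse-∷ q x (_ ∷ _) = refl

orient-diffuse : ∀ {n} p x y (r : Config n) →
  orient (x +ℤ (flux p - flux (orient x y))) (head (diffuse (orient x y) (y ∷ r)))
    ≡ signDir (newGap p (x - y) (firstEdge (induced (y ∷ r))))
orient-diffuse p x y r = begin
  orient (x +ℤ (flux p - flux e)) (head (diffuse e (y ∷ r)))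
    ≡⟨ cong (orient (x +ℤ (flux p - flux e))) (head-diffuse e y r) ⟩
  orient (x +ℤ (flux p - flux e)) (y +ℤ (flux e - flux d))
    ≡⟨ orient≡signDir (x +ℤ (flux p - flux e)) (y +ℤ (flux e - flux d)) ⟩
  signDir ((x +ℤ (flux p - flux e)) - (y +ℤ (flux e - flux d)))
    ≡⟨ cong signDir (gaps x y (flux p) (flux e) (flux d)) ⟩
  signDir ((x - y) +ℤ ((flux p - flux e) +ℤ (flux d - flux e)))
    ≡⟨ cong (λ c → signDir ((x - y) +ℤ ((flux p - flux c) +ℤ (flux d - flux c)))) (orient≡signDir x y) ⟩
  signDir (newGap p (x - y) d) ∎
  where
  open ≡-Reasoning
  e d : EdgeDir
  e = orient x y
  d = firstEdge (induced (y ∷ r))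
  gaps : ∀ x y p e d → (x +ℤ (p - e)) - (y +ℤ (e - d)) ≡ (x - y) +ℤ ((p - e) +ℤ (d - e))
  gaps = ℤSolver.solve-∀

returns⇔reverses : ∀ x p e e' → (x +ℤ (flux p - flux e)) +ℤ (flux (opposite p) - flux e') ≡ x ⇔ e' ≡ opposite e
returns⇔reverses x p e e' = mk⇔ to from
  where
  to : (x +ℤ (flux p - flux e)) +ℤ (flux (opposite p) - flux e') ≡ x → e' ≡ opposite e
  to returns = flux≡-flux⇒opposite e e' (begin
    flux e'
      ≡⟨ isolate x (flux p) (flux e) (flux e') ⟩
    - flux e +ℤ (x - ((x +ℤ (flux p - flux e)) +ℤ (- flux p - flux e')))
      ≡⟨ cong (λ z → - flux e +ℤ (x - ((x +ℤ (flux p - flux e)) +ℤ (z - flux e')))) (sym (flux-opposite p)) ⟩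
    - flux e +ℤ (x - ((x +ℤ (flux p - flux e)) +ℤ (flux (opposite p) - flux e')))
      ≡⟨ cong (λ z → - flux e +ℤ (x - z)) returns ⟩
    - flux e +ℤ (x - x)
      ≡⟨ cong (- flux e +ℤ_) (ℤP.+-inverseʳ x) ⟩
    - flux e +ℤ + 0
      ≡⟨ ℤP.+-identityʳ (- flux e) ⟩
    - flux e ∎)
    where
    open ≡-Reasoning
    isolate : ∀ x p e e' → e' ≡ - e +ℤ (x - ((x +ℤ (p - e)) +ℤ (- p - e')))
    isolate = ℤSolver.solve-∀
  from : e' ≡ opposite e → (x +ℤ (flux p - flux e)) +ℤ (flux (opposite p) - flux e') ≡ x
  from refl = trans (cong₂ (λ a b → (x +ℤ (flux p - flux e)) +ℤ (a - b)) (flux-opposite p) (flux-opposite e))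
                    (cancel x (flux p) (flux e))
    where
    cancel : ∀ x p e → (x +ℤ (p - e)) +ℤ (- p - - e) ≡ x
    cancel = ℤSolver.solve-∀

diffuse²-∷∷ : ∀ {n} p x y (r : Config n) →
  diffuse (opposite p) (diffuse p (x ∷ y ∷ r)) ≡ x ∷ y ∷ r
    ⇔ (signDir (newGap p (x - y) (firstEdge (induced (y ∷ r)))) ≡ opposite (orient x y)
       × diffuse (opposite (orient x y)) (diffuse (orient x y) (y ∷ r)) ≡ y ∷ r)
diffuse²-∷∷ p x y r = mk⇔ to from
  where
  e e' : EdgeDir
  X : ℤ
  V : Config (suc _)
  e  = orient x y
  X  = x +ℤ (flux p - flux e)
  V  = diffuse e (y ∷ r)
  e' = orient X (head V)

  unfold : diffuse (opposite p) (diffuse p (x ∷ y ∷ r)) ≡ X +ℤ (flux (opposite p) - flux e') ∷ diffuse e' V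
  unfold = diffuse-∷ (opposite p) X V

  to : diffuse (opposite p) (diffuse p (x ∷ y ∷ r)) ≡ x ∷ y ∷ r →
       signDir (newGap p (x - y) (firstEdge (induced (y ∷ r)))) ≡ opposite e × diffuse (opposite e) V ≡ y ∷ r
  to back with Vec.∷-injective (trans (sym unfold) back)
  ... | returns , back′ = trans (sym (orient-diffuse p x y r)) e'≡ , subst (λ q → diffuse q V ≡ y ∷ r) e'≡ back′
    where
    e'≡ : e' ≡ opposite e
    e'≡ = Equivalence.to (returns⇔reverses x p e e') returns

  from : signDir (newGap p (x - y) (firstEdge (induced (y ∷ r)))) ≡ opposite e × diffuse (opposite e) V ≡ y ∷ r →
         diffuse (opposite p) (diffuse p (x ∷ y ∷ r)) ≡ x ∷ y ∷ r
  from (flips , back′) =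
    trans unfold (cong₂ _∷_ (Equivalence.from (returns⇔reverses x p e e') e'≡) (trans (cong (λ q → diffuse q V) e'≡) back′))
    where
    e'≡ : e' ≡ opposite e
    e'≡ = trans (orient-diffuse p x y r) flips

period-two⇒AllReverse : ∀ {n} p (D : Config (suc n)) → diffuse (opposite p) (diffuse p D) ≡ D → AllReverse p (induced D)
period-two⇒AllReverse p (x ∷ [])    _    = tt
period-two⇒AllReverse p (x ∷ y ∷ r) back with Equivalence.to (diffuse²-∷∷ p x y r) back
... | flips , back′ =
  subst (λ c → T (reverses p c (firstEdge (induced (y ∷ r))))) (sym (orient≡signDir x y))
        (reverses-minimal p (x - y) (firstEdge (induced (y ∷ r))) (trans flips (cong opposite (orient≡signDir x y))))
  , period-two⇒AllReverse (orient x y) (y ∷ r) back′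

AllReverse⇒period-two : ∀ {m} p x (w : PathOrientation m) → AllReverse p w →
  diffuse (opposite p) (diffuse p (staircase x w)) ≡ staircase x w
AllReverse⇒period-two p x [] _ = cong (_∷ []) (begin
  (x +ℤ flux p) +ℤ flux (opposite p) ≡⟨ cong ((x +ℤ flux p) +ℤ_) (flux-opposite p) ⟩
  (x +ℤ flux p) +ℤ - flux p          ≡⟨ cancel x (flux p) ⟩
  x                                  ∎)
  where
  open ≡-Reasoning
  cancel : ∀ x s → (x +ℤ s) +ℤ - s ≡ x
  cancel = ℤSolver.solve-∀
AllReverse⇒period-two p x (c ∷ w) (flips , rest) =
  Equivalence.from (diffuse²-∷∷ p x y (stairsBelow y w)) (flips′ , back)
  where
  open ≡-Reasoning
  y : ℤ
  y = x - flux c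
  flips′ : signDir (newGap p (x - y) (firstEdge (induced (staircase y w)))) ≡ opposite (orient x y)
  flips′ = begin
    signDir (newGap p (x - y) (firstEdge (induced (staircase y w))))
      ≡⟨ cong₂ (λ δ d → signDir (newGap p δ d)) (x-[x-s]≡s x (flux c)) (cong firstEdge (induced-staircase y w)) ⟩
    signDir (newGap p (flux c) (firstEdge w)) ≡⟨ toWitness flips ⟩
    opposite c                                ≡⟨ cong opposite (sym (orient-staircase x c)) ⟩
    opposite (orient x y)                     ∎
  back : diffuse (opposite (orient x y)) (diffuse (orient x y) (staircase y w)) ≡ staircase y w
  back = subst (λ e → diffuse (opposite e) (diffuse e (staircase y w)) ≡ staircase y w)
               (sym (orient-staircase x c)) (AllReverse⇒period-two c y w rest)

reverses-flat-flat : ∀ d → T (reverses flat flat d) → d ≡ flat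
reverses-flat-flat flat _ = refl

flatStart⇒fixed : ∀ {n} (D : Config (suc n)) → AllReverse flat (induced D) → firstEdge (induced D) ≡ flat → diffuse flat D ≡ D
flatStart⇒fixed (x ∷ [])    _             _      = cong (_∷ []) (ℤP.+-identityʳ x)
flatStart⇒fixed (x ∷ y ∷ r) (rev , rest) e≡flat rewrite e≡flat =
  cong₂ _∷_ (ℤP.+-identityʳ x) (flatStart⇒fixed (y ∷ r) rest (reverses-flat-flat _ rev))

fixed⇒flatStart : ∀ {n} (D : Config (suc n)) → diffuse flat D ≡ D → firstEdge (induced D) ≡ flat
fixed⇒flatStart (x ∷ [])    _     = refl
fixed⇒flatStart (x ∷ y ∷ r) fixed = begin
  orient x y                          ≡⟨ sym (signDir-flux (orient x y)) ⟩
  signDir (flux (orient x y))         ≡⟨ cong signDir (isolate x (flux (orient x y))) ⟩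
  signDir (x - (x +ℤ (+ 0 - flux (orient x y)))) ≡⟨ cong (λ z → signDir (x - z)) (Vec.∷-injectiveˡ fixed) ⟩
  signDir (x - x)                     ≡⟨ cong signDir (ℤP.+-inverseʳ x) ⟩
  flat                                ∎
  where
  open ≡-Reasoning
  isolate : ∀ x s → s ≡ x - (x +ℤ (+ 0 - s))
  isolate = ℤSolver.solve-∀

isP2Orientation⇔ : ∀ {m} (w : PathOrientation m) → IsP2Orientation w ⇔ (AllReverse flat w × ¬ firstEdge w ≡ flat)
isP2Orientation⇔ {m} w = mk⇔ to from
  where
  G : SimpleGraph (suc m)
  G = path (suc m)

  period-two⇔ : ∀ D → (step G (step G D) ≡ D) ⇔ (diffuse flat (diffuse flat D) ≡ D)
  period-two⇔ D rewrite step-path (step G D) | step-path D = mk⇔ id id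

  fixed⇔ : ∀ D → (step G D ≡ D) ⇔ (diffuse flat D ≡ D)
  fixed⇔ D rewrite step-path D = mk⇔ id id

  to : IsP2Orientation w → AllReverse flat w × ¬ firstEdge w ≡ flat
  to (D , p2 , refl) with isP2Config⇒period-two G D p2
  ... | back , moves = rev , λ flatStart → moves (Equivalence.from (fixed⇔ D) (flatStart⇒fixed D rev flatStart))
    where
    rev : AllReverse flat (induced D)
    rev = period-two⇒AllReverse flat D (Equivalence.to (period-two⇔ D) back)

  from : AllReverse flat w × ¬ firstEdge w ≡ flat → IsP2Orientation w
  from (rev , nonflat) = D , period-two⇒isP2Config G D back moves , induced-staircase (+ 0) w
    where
    D : Config (suc m)
    D = staircase (+ 0) w
    back : step G (step G D) ≡ D
    back = Equivalence.from (period-two⇔ D) (AllReverse⇒period-two flat (+ 0) w rev)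
    moves : ¬ step G D ≡ D
    moves fixed = nonflat (trans (sym (cong firstEdge (induced-staircase (+ 0) w)))
                                (fixed⇒flatStart D (Equivalence.to (fixed⇔ D) fixed)))

branch : ∀ {m} → (EdgeDir → List (PathOrientation m)) → List (PathOrientation (suc m))
branch f = List.map (flat ∷_) (f flat) ++ (List.map (forward ∷_) (f forward) ++ List.map (backward ∷_) (f backward))

∈-map-∷⁻ : ∀ {m c d} {w : PathOrientation m} xs → (d ∷ w) ∈ List.map (c ∷_) xs → d ≡ c × w ∈ xs
∈-map-∷⁻ xs i with ∈-map⁻ _ i
... | _ , j , refl = refl , j

∈-branch⁺ : ∀ {m} f d {w : PathOrientation m} → w ∈ f d → (d ∷ w) ∈ branch f
∈-branch⁺ f flat     i = ∈-++⁺ˡ (∈-map⁺ (flat ∷_) i)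
∈-branch⁺ f forward  i = ∈-++⁺ʳ (List.map (flat ∷_) (f flat)) (∈-++⁺ˡ (∈-map⁺ (forward ∷_) i))
∈-branch⁺ f backward i = ∈-++⁺ʳ (List.map (flat ∷_) (f flat)) (∈-++⁺ʳ (List.map (forward ∷_) (f forward)) (∈-map⁺ (backward ∷_) i))

∈-branch⁻ : ∀ {m} f d {w : PathOrientation m} → (d ∷ w) ∈ branch f → w ∈ f d
∈-branch⁻ f d i with ∈-++⁻ (List.map (flat ∷_) (f flat)) i
... | inj₁ j with ∈-map-∷⁻ (f flat) j
...   | refl , k = k
∈-branch⁻ f d i | inj₂ j with ∈-++⁻ (List.map (forward ∷_) (f forward)) j
... | inj₁ k with ∈-map-∷⁻ (f forward) k
...   | refl , l = l
∈-branch⁻ f d i | inj₂ j | inj₂ k with ∈-map-∷⁻ (f backward) k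
...   | refl , l = l

branch-unique : ∀ {m} (f : EdgeDir → List (PathOrientation m)) → (∀ d → Unique (f d)) → Unique (branch f)
branch-unique f unique =
  Unique.++⁺ (block flat) (Unique.++⁺ (block forward) (block backward) forward#backward) flat#rest
  where
  block : ∀ d → Unique (List.map (d ∷_) (f d))
  block d = Unique.map⁺ Vec.∷-injectiveʳ (unique d)
  headOf : ∀ {d v} → v ∈ List.map (d ∷_) (f d) → head v ≡ d
  headOf i with ∈-map⁻ _ i
  ... | _ , _ , refl = refl
  forward#backward : Disjoint (List.map (forward ∷_) (f forward)) (List.map (backward ∷_) (f backward))
  forward#backward (i , j) with trans (sym (headOf i)) (headOf j)
  ... | ()
  flat#rest : Disjoint (List.map (flat ∷_) (f flat)) (List.map (forward ∷_) (f forward) ++ List.map (backward ∷_) (f backward))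
  flat#rest (i , j) with ∈-++⁻ (List.map (forward ∷_) (f forward)) j
  ... | inj₁ k with trans (sym (headOf i)) (headOf k)
  ...   | ()
  flat#rest (i , j) | inj₂ k with trans (sym (headOf i)) (headOf k)
  ...   | ()

length-branch : ∀ {m} (f : EdgeDir → List (PathOrientation m)) →
  length (branch f) ≡ length (f flat) + (length (f forward) + length (f backward))
length-branch f = begin
  length (branch f)
    ≡⟨ List.length-++ (List.map (flat ∷_) (f flat)) ⟩
  length (List.map (flat ∷_) (f flat)) + length (List.map (forward ∷_) (f forward) ++ List.map (backward ∷_) (f backward))
    ≡⟨ cong₂ _+_ refl (List.length-++ (List.map (forward ∷_) (f forward))) ⟩
  length (List.map (flat ∷_) (f flat)) + (length (List.map (forward ∷_) (f forward)) + length (List.map (backward ∷_) (f backward)))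
    ≡⟨ cong₂ _+_ (List.length-map (flat ∷_) (f flat))
             (cong₂ _+_ (List.length-map (forward ∷_) (f forward)) (List.length-map (backward ∷_) (f backward))) ⟩
  length (f flat) + (length (f forward) + length (f backward)) ∎
  where open ≡-Reasoning

∈-if⁺ : ∀ {A : Set} b {xs : List A} {v} → T b → v ∈ xs → v ∈ (if b then xs else [])
∈-if⁺ true _ i = i

∈-if⁻ : ∀ {A : Set} b {xs : List A} {v} → v ∈ (if b then xs else []) → T b × v ∈ xs
∈-if⁻ true i = tt , i

unique-if : ∀ {A : Set} b {xs : List A} → Unique xs → Unique (if b then xs else [])
unique-if true  u = u
unique-if false _ = AllPairs.[]

reversingTails : EdgeDir → EdgeDir → (m : ℕ) → List (PathOrientation m)
tailsAfter : EdgeDir → EdgeDir → (m : ℕ) → EdgeDir → List (PathOrientation m)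
reversingTails p c zero    = if reverses p c flat then [] ∷ [] else []
reversingTails p c (suc m) = branch (tailsAfter p c m)
tailsAfter p c m d = if reverses p c d then reversingTails c d m else []

∈-reversingTails⁺ : ∀ p c {m} (w : PathOrientation m) → AllReverse p (c ∷ w) → w ∈ reversingTails p c m
∈-reversingTails⁺ p c []      (rev , _)          = ∈-if⁺ (reverses p c flat) rev (here refl)
∈-reversingTails⁺ p c (d ∷ w) (rev , rest) =
  ∈-branch⁺ (tailsAfter p c _) d (∈-if⁺ (reverses p c d) rev (∈-reversingTails⁺ c d w rest))

∈-reversingTails⁻ : ∀ p c {m} (w : PathOrientation m) → w ∈ reversingTails p c m → AllReverse p (c ∷ w)
∈-reversingTails⁻ p c []      i = proj₁ (∈-if⁻ (reverses p c flat) i) , tt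
∈-reversingTails⁻ p c (d ∷ w) i with ∈-if⁻ (reverses p c d) (∈-branch⁻ (tailsAfter p c _) d i)
... | rev , j = rev , ∈-reversingTails⁻ c d w j

reversingTails-unique : ∀ p c m → Unique (reversingTails p c m)
reversingTails-unique p c zero    = unique-if (reverses p c flat) ([] AllPairs.∷ AllPairs.[])
reversingTails-unique p c (suc m) = branch-unique (tailsAfter p c m) λ d → unique-if (reverses p c d) (reversingTails-unique c d m)

p2Tails : (m : ℕ) → EdgeDir → List (PathOrientation m)
p2Tails m flat = []
p2Tails m c    = reversingTails flat c m

p2Orientations : (m : ℕ) → List (PathOrientation m)
p2Orientations zero    = []
p2Orientations (suc m) = branch (p2Tails m)

∈-p2Orientations⇔ : ∀ {m} (w : PathOrientation m) → w ∈ p2Orientations m ⇔ (AllReverse flat w × ¬ firstEdge w ≡ flat)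
∈-p2Orientations⇔ w = mk⇔ (to w) (from w)
  where
  to : ∀ {m} (w : PathOrientation m) → w ∈ p2Orientations m → AllReverse flat w × ¬ firstEdge w ≡ flat
  to (flat     ∷ w) i with () ← ∈-branch⁻ (p2Tails _) flat i
  to (forward  ∷ w) i = ∈-reversingTails⁻ flat forward w (∈-branch⁻ (p2Tails _) forward i) , λ ()
  to (backward ∷ w) i = ∈-reversingTails⁻ flat backward w (∈-branch⁻ (p2Tails _) backward i) , λ ()
  from : ∀ {m} (w : PathOrientation m) → AllReverse flat w × ¬ firstEdge w ≡ flat → w ∈ p2Orientations m
  from []             (_ , nonflat) = ⊥-elim (nonflat refl)
  from (flat     ∷ w) (_ , nonflat) = ⊥-elim (nonflat refl)
  from (forward  ∷ w) (rev , _)     = ∈-branch⁺ (p2Tails _) forward (∈-reversingTails⁺ flat forward w rev)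
  from (backward ∷ w) (rev , _)     = ∈-branch⁺ (p2Tails _) backward (∈-reversingTails⁺ flat backward w rev)

p2Orientations-unique : ∀ m → Unique (p2Orientations m)
p2Orientations-unique zero    = AllPairs.[]
p2Orientations-unique (suc m) = branch-unique (p2Tails m) unique
  where
  unique : ∀ c → Unique (p2Tails m c)
  unique flat     = AllPairs.[]
  unique forward  = reversingTails-unique flat forward m
  unique backward = reversingTails-unique flat backward m

isYes-opposite : ∀ a b → isYes (opposite a ≟ opposite b) ≡ isYes (a ≟ b)
isYes-opposite flat     flat     = refl
isYes-opposite flat     forward  = refl
isYes-opposite flat     backward = refl
isYes-opposite forward  flat     = refl
isYes-opposite forward  forward  = refl
isYes-opposite forward  backward = refl
isYes-opposite backward flat     = refl
isYes-opposite backward forward  = refl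
isYes-opposite backward backward = refl

newGap-opposite : ∀ p c d → newGap (opposite p) (flux (opposite c)) (opposite d) ≡ - newGap p (flux c) d
newGap-opposite p c d
  rewrite signDir-flux c | signDir-flux (opposite c) | flux-opposite p | flux-opposite c | flux-opposite d
  = negated (flux p) (flux c) (flux d)
  where
  negated : ∀ p c d → - c +ℤ ((- p - - c) +ℤ (- d - - c)) ≡ - (c +ℤ ((p - c) +ℤ (d - c)))
  negated = ℤSolver.solve-∀

reverses-opposite : ∀ p c d → reverses (opposite p) (opposite c) (opposite d) ≡ reverses p c d
reverses-opposite p c d = begin
  isYes (signDir (newGap (opposite p) (flux (opposite c)) (opposite d)) ≟ opposite (opposite c))
    ≡⟨ cong (λ z → isYes (signDir z ≟ opposite (opposite c))) (newGap-opposite p c d) ⟩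
  isYes (signDir (- newGap p (flux c) d) ≟ opposite (opposite c))
    ≡⟨ cong (λ e → isYes (e ≟ opposite (opposite c))) (signDir-neg (newGap p (flux c) d)) ⟩
  isYes (opposite (signDir (newGap p (flux c) d)) ≟ opposite (opposite c))
    ≡⟨ isYes-opposite (signDir (newGap p (flux c) d)) (opposite c) ⟩
  reverses p c d ∎
  where open ≡-Reasoning

count : EdgeDir → EdgeDir → ℕ → ℕ
count p c m = length (reversingTails p c m)

count-opposite : ∀ p c m → count (opposite p) (opposite c) m ≡ count p c m
length-tailsAfter-opposite : ∀ p c m d →
  length (tailsAfter (opposite p) (opposite c) m (opposite d)) ≡ length (tailsAfter p c m d)

count-opposite p c zero    = cong (λ b → length (if b then [] ∷ [] else [])) (reverses-opposite p c flat)
count-opposite p c (suc m) = begin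
  length (branch (tailsAfter (opposite p) (opposite c) m))
    ≡⟨ length-branch (tailsAfter (opposite p) (opposite c) m) ⟩
  length′ (opposite p) (opposite c) flat + (length′ (opposite p) (opposite c) forward + length′ (opposite p) (opposite c) backward)
    ≡⟨ cong₂ _+_ (length-tailsAfter-opposite p c m flat)
                 (cong₂ _+_ (length-tailsAfter-opposite p c m backward) (length-tailsAfter-opposite p c m forward)) ⟩
  length′ p c flat + (length′ p c backward + length′ p c forward)
    ≡⟨ cong (λ n → length′ p c flat + n) (ℕ.+-comm (length′ p c backward) (length′ p c forward)) ⟩
  length′ p c flat + (length′ p c forward + length′ p c backward)
    ≡⟨ sym (length-branch (tailsAfter p c m)) ⟩
  length (branch (tailsAfter p c m)) ∎
  where
  open ≡-Reasoning
  length′ : EdgeDir → EdgeDir → EdgeDir → ℕ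
  length′ p c d = length (tailsAfter p c m d)

length-tailsAfter-opposite p c m d rewrite reverses-opposite p c d with reverses p c d
... | true  = count-opposite c d m
... | false = refl

count-flat-forward : ∀ m → count flat forward (suc m) ≡ count forward flat m + count forward backward m
count-flat-forward m = length-branch (tailsAfter flat forward m)

count-forward-flat : ∀ m → count forward flat (suc m) ≡ count flat forward m
count-forward-flat m = trans (length-branch (tailsAfter forward flat m)) (count-opposite flat forward m)

count-forward-backward : ∀ m →
  count forward backward (suc m) ≡ count forward flat m + (count forward backward m + count forward forward m)
count-forward-backward m = trans (length-branch (tailsAfter forward backward m))
  (cong₂ _+_ (count-opposite forward flat m) (cong₂ _+_ (count-opposite forward backward m) (count-opposite forward forward m)))

count-forward-forward : ∀ m → count forward forward (suc m) ≡ count forward backward m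
count-forward-forward m = length-branch (tailsAfter forward forward m)

count-flat-forward-recurrence : ∀ k →
  count flat forward (4 + k) + count flat forward k ≡ count flat forward (3 + k) + 2 * count flat forward (2 + k)
count-flat-forward-recurrence k = begin
  A (4 + k) + A k                                        ≡⟨ cong (_+ A k) A₄ ⟩
  (A (2 + k) + (B (2 + k) + (C (2 + k) + C (1 + k)))) + A k ≡⟨ cong (λ a → (a + (B (2 + k) + (C (2 + k) + C (1 + k)))) + A k) A₂ ⟩
  ((A k + C (1 + k)) + (B (2 + k) + (C (2 + k) + C (1 + k)))) + A k
    ≡⟨ rearrange (A k) (B (2 + k)) (C (2 + k)) (C (1 + k)) ⟩
  (B (2 + k) + C (2 + k)) + 2 * (A k + C (1 + k))       ≡⟨ cong₂ (λ a b → a + 2 * b) (sym (count-flat-forward (2 + k))) (sym A₂) ⟩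
  A (3 + k) + 2 * A (2 + k)                              ∎
  where
  open ≡-Reasoning
  A B C : ℕ → ℕ
  A = count flat forward
  B = count forward flat
  C = count forward backward
  A₂ : A (2 + k) ≡ A k + C (1 + k)
  A₂ = trans (count-flat-forward (1 + k)) (cong (_+ C (1 + k)) (count-forward-flat k))
  A₄ : A (4 + k) ≡ A (2 + k) + (B (2 + k) + (C (2 + k) + C (1 + k)))
  A₄ = trans (count-flat-forward (3 + k))
    (cong₂ _+_ (count-forward-flat (2 + k))
               (trans (count-forward-backward (2 + k)) (cong (λ d → B (2 + k) + (C (2 + k) + d)) (count-forward-forward (1 + k)))))
  rearrange : ∀ a b c c′ → ((a + c′) + (b + (c + c′))) + a ≡ (b + c) + 2 * (a + c′)
  rearrange = ℕSolver.solve-∀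

length-p2Orientations : ∀ k → length (p2Orientations (suc k)) ≡ count flat forward k + count flat forward k
length-p2Orientations k = trans (length-branch (p2Tails k)) (cong (λ n → count flat forward k + n) (count-opposite flat forward k))

p2Count : ℕ → ℕ
p2Count n = length (p2Orientations (pred n))

p2Count-recurrence : ∀ n → p2Count (n + 5) + p2Count (n + 1) ≡ p2Count (n + 4) + 2 * p2Count (n + 3)
p2Count-recurrence zero = refl
p2Count-recurrence (suc k)
  rewrite ℕ.+-comm k 5 | ℕ.+-comm k 1 | ℕ.+-comm k 4 | ℕ.+-comm k 3
        | length-p2Orientations (4 + k) | length-p2Orientations k
        | length-p2Orientations (3 + k) | length-p2Orientations (2 + k)
  = doubled (count flat forward (4 + k)) (count flat forward k) (count flat forward (3 + k)) (count flat forward (2 + k))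
            (count-flat-forward-recurrence k)
  where
  doubled : ∀ a b c d → a + b ≡ c + 2 * d → (a + a) + (b + b) ≡ (c + c) + 2 * (d + d)
  doubled a b c d eq = begin
    (a + a) + (b + b) ≡⟨ double-sum a b ⟩
    2 * (a + b)       ≡⟨ cong (2 *_) eq ⟩
    2 * (c + 2 * d)   ≡⟨ sym (double-sum-rhs c d) ⟩
    (c + c) + 2 * (d + d) ∎
    where
    open ≡-Reasoning
    double-sum : ∀ a b → (a + a) + (b + b) ≡ 2 * (a + b)
    double-sum = ℕSolver.solve-∀
    double-sum-rhs : ∀ c d → (c + c) + 2 * (d + d) ≡ 2 * (c + 2 * d)
    double-sum-rhs = ℕSolver.solve-∀

theorem3 : Σ (ℕ → ℕ) λ R →
    (∀ n → NumP2Orientations≡ (suc n) (R (suc n)))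
    × R 1 ≡ 0 × R 2 ≡ 2 × R 3 ≡ 2 × R 4 ≡ 4
    × (∀ n → R (n + 5) + R (n + 1) ≡ R (n + 4) + 2 * R (n + 3))
theorem3 = p2Count , counts , refl , refl , refl , refl , p2Count-recurrence
  where
  counts : ∀ m → NumP2Orientations≡ (suc m) (p2Count (suc m))
  counts m = p2Orientations m , p2Orientations-unique m
           , (λ w → ⇔.trans (∈-p2Orientations⇔ w) (⇔.sym (isP2Orientation⇔ w))) , refl
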